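{- Let $\mathbf{L}\in\mathrm{Mod}(\mathrm{Eq}(\mathbb{AOL})\cup\{\mathrm{SK},\mathrm{SDM}\})$. Then for all $a,b,c\in L$: (i) $a\vee\Box b=(a\vee b)\wedge(\Diamond a\vee\Box b)$; (ii) $a\vee(b\wedge c)=a\vee((\Diamond b\vee\Box a)\wedge(a\vee b)\wedge c)$; (iii) $a\vee(b\wedge c)=a\vee((a\vee b)\wedge c)$; (iv) $a\wedge(b\vee c)=a\wedge(b\vee(a\wedge c))$; (v) $a\wedge(b\vee c)=(a\wedge b)\vee(a\wedge c)$.
   Context: A bounded involution lattice is a bounded lattice with an order-reversing involution $'$; it is a pseudo-Kleene algebra if $a\wedge a'\leq b\vee b'$ for all $a,b$. A BZ-lattice is an algebra $\langle B,\wedge,\vee,',^{\sim},0,1\rangle$ whose $^{\sim}$-free reduct is a pseudo-Kleene algebra and which satisfies: $a\wedge a^{\sim}=0$; $a\leq a^{\sim\sim}$; $a\leq b$ implies $b^{\sim}\leq a^{\sim}$; $a^{\sim\prime}=a^{\sim\sim}$. Write $\Diamond x=x^{\sim\sim}$, $\Box x=x'^{\sim}$. A PBZ*-lattice is a BZ-lattice satisfying $(a\wedge a')^{\sim}\leq a^{\sim}\vee a'^{\sim}$ and $(a^{\sim}\vee(\Diamond a\wedge\Diamond b))\wedge\Diamond a\leq\Diamond b$. An antiortholattice is a PBZ*-lattice whose only elements $a$ with $a\wedge a'=0$ are $0$ and $1$; $\mathrm{Eq}(\mathbb{AOL})$ is the set of identities valid in all antiortholattices, and $\mathrm{Mod}(\Sigma)$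 is the class of algebras satisfying $\Sigma$. (SK) is the identity $x\wedge\Diamond y\leq\Box x\vee y$; (SDM) is $(x\wedge y)^{\sim}\approx x^{\sim}\vee y^{\sim}$. -}

module Defs where

open import Data.Nat using (ℕ)
open import Data.Sum using (_⊎_)
open import Data.Product using (_×_)
open import Relation.Binary.PropositionalEquality using (_≡_)

record BZAlg : Set₁ where
  infixr 7 _∧_
  infixr 6 _∨_
  field
    Carrier : Set
    _∧_ _∨_ : Carrier → Carrier → Carrier
    _′ : Carrier → Carrier
    _~ : Carrier → Carrier
    𝟘 𝟙 : Carrier

  _≤_ : Carrier → Carrier → Set
  a ≤ b = a ∧ b ≡ a

  ◇ : Carrier → Carrier
  ◇ x = (x ~) ~

  □ : Carrier → Carrier
  □ x = (x ′) ~

record IsAOL (A : BZAlg) : Set where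
  open BZAlg A
  field
    ∧-comm : ∀ a b → a ∧ b ≡ b ∧ a
    ∨-comm : ∀ a b → a ∨ b ≡ b ∨ a
    ∧-assoc : ∀ a b c → (a ∧ b) ∧ c ≡ a ∧ (b ∧ c)
    ∨-assoc : ∀ a b c → (a ∨ b) ∨ c ≡ a ∨ (b ∨ c)
    ∧-absorb : ∀ a b → a ∧ (a ∨ b) ≡ a
    ∨-absorb : ∀ a b → a ∨ (a ∧ b) ≡ a
    𝟘-least : ∀ a → 𝟘 ≤ a
    𝟙-greatest : ∀ a → a ≤ 𝟙
    ′-invol : ∀ a → (a ′) ′ ≡ a
    ′-antitone : ∀ a b → a ≤ b → (b ′) ≤ (a ′)
    pseudoKleene : ∀ a b → (a ∧ a ′) ≤ (b ∨ b ′)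
    ~-meet : ∀ a → a ∧ a ~ ≡ 𝟘
    ~-dbl : ∀ a → a ≤ ((a ~) ~)
    ~-antitone : ∀ a b → a ≤ b → (b ~) ≤ (a ~)
    ~′ : ∀ a → (a ~) ′ ≡ (a ~) ~
    star : ∀ a → ((a ∧ a ′) ~) ≤ (a ~ ∨ (a ′) ~)
    pbz : ∀ a b → ((a ~ ∨ (◇ a ∧ ◇ b)) ∧ ◇ a) ≤ ◇ b
    sharp01 : ∀ a → a ∧ a ′ ≡ 𝟘 → (a ≡ 𝟘) ⊎ (a ≡ 𝟙)

data Term : Set where
  var : ℕ → Term
  _∧ₜ_ _∨ₜ_ : Term → Term → Term
  _′ₜ _~ₜ : Term → Term
  𝟘ₜ 𝟙ₜ : Term

eval : (A : BZAlg) → (ℕ → BZAlg.Carrier A) → Term → BZAlg.Carrier A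
eval A ρ (var n) = ρ n
eval A ρ (t ∧ₜ u) = BZAlg._∧_ A (eval A ρ t) (eval A ρ u)
eval A ρ (t ∨ₜ u) = BZAlg._∨_ A (eval A ρ t) (eval A ρ u)
eval A ρ (t ′ₜ) = BZAlg._′ A (eval A ρ t)
eval A ρ (t ~ₜ) = BZAlg._~ A (eval A ρ t)
eval A ρ 𝟘ₜ = BZAlg.𝟘 A
eval A ρ 𝟙ₜ = BZAlg.𝟙 A

Satisfies : BZAlg → Term → Term → Set
Satisfies A t u = ∀ (ρ : ℕ → BZAlg.Carrier A) → eval A ρ t ≡ eval A ρ u

InEqAOL : Term → Term → Set₁
InEqAOL t u = ∀ (A : BZAlg) → IsAOL A → Satisfies A t u

ModEqAOL : BZAlg → Set₁
ModEqAOL L = ∀ t u → InEqAOL t u → Satisfies L t u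

SK : BZAlg → Set
SK L = ∀ x y → (x ∧ ◇ y) ≤ (□ x ∨ y)
  where open BZAlg L

SDM : BZAlg → Set
SDM L = ∀ x y → (x ∧ y) ~ ≡ x ~ ∨ y ~
  where open BZAlg L

Conclusion : BZAlg → Set
Conclusion L = ∀ a b c →
    (a ∨ □ b ≡ (a ∨ b) ∧ (◇ a ∨ □ b))
  × (a ∨ (b ∧ c) ≡ a ∨ ((◇ b ∨ □ a) ∧ (a ∨ b) ∧ c))
  × (a ∨ (b ∧ c) ≡ a ∨ ((a ∨ b) ∧ c))
  × (a ∧ (b ∨ c) ≡ a ∧ (b ∨ (a ∧ c)))
  × (a ∧ (b ∨ c) ≡ (a ∧ b) ∨ (a ∧ c))
  where open BZAlg L

module Submission where

-- In an antiortholattice every element of the form x~ is sharp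
-- (x~ ∧ x~′ = x~ ∧ x~~ = 0), hence equal to 0 or 1; so ◇x and □x always lie in
-- {0,1}, and □x ≤ x ≤ ◇x.  Elements 0 and 1 behave distributively, which makes
-- three lattice inequalities in ◇ and □ valid in every antiortholattice; being
-- identities they hold in every L ∈ Mod(Eq(AOL)).  In L, (SK) bounds the
-- "defect" terms b ∧ ◇a and X ∧ ◇b (X = (a ∨ b) ∧ c) that appear in them,
-- which yields (i) and the modular inequality (a ∨ b) ∧ c ≤ a ∨ (b ∧ c).
-- That inequality gives (ii) and (iii), and in any lattice it implies
-- distributivity, i.e. (iv) and (v).

open import Defs
open import Data.Nat using (ℕ)
open import Data.Sum using (_⊎_; inj₁; inj₂)
open import Data.Product using (_,_)
open import Relation.Binary.PropositionalEquality
  using (_≡_; refl; sym; trans; cong; cong₂; isEquivalence)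
open import Algebra.Lattice.Structures using (IsLattice)
open import Algebra.Lattice.Properties.Lattice using (∨-∧-orderTheoreticLattice)
import Relation.Binary.Lattice as Order
import Relation.Binary.Lattice.Properties.JoinSemilattice as JoinProperties
import Relation.Binary.Lattice.Properties.MeetSemilattice as MeetProperties
import Relation.Binary.Reasoning.PartialOrder as ≤-Reasoning

IsLatticeReduct : BZAlg → Set
IsLatticeReduct A = IsLattice _≡_ (BZAlg._∨_ A) (BZAlg._∧_ A)

-- Order-theoretic view of a lattice reduct, taken from the standard library.
-- The library orders by a ≼ b ⇔ a ≡ a ∧ b, which is Defs' a ≤ b read backwards.
module LatticeOrder (A : BZAlg) (lat : IsLatticeReduct A) where
  open BZAlg A

  orderLattice : Order.Lattice _ _ _
  orderLattice = ∨-∧-orderTheoreticLattice (record { isLattice = lat })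

  open Order.Lattice orderLattice public
    using (poset; x≤x∨y; y≤x∨y; ∨-least; x∧y≤x; x∧y≤y; ∧-greatest)
    renaming (_≤_ to _≼_; refl to ≼-refl; trans to ≼-trans;
              antisym to ≼-antisym; reflexive to ≼-reflexive)
  open JoinProperties (Order.Lattice.joinSemilattice orderLattice) public
    using (∨-monotonic)
  open MeetProperties (Order.Lattice.meetSemilattice orderLattice) public
    using (∧-monotonic)
  open IsLattice lat public using (∧-comm; ∨-comm)
  open ≤-Reasoning poset public

  ≤⇒≼ : ∀ {a b} → a ≤ b → a ≼ b
  ≤⇒≼ = sym

  ≼⇒≤ : ∀ {a b} → a ≼ b → a ≤ b
  ≼⇒≤ = sym

  module Distributivity
    (modular : ∀ a b c → (a ∨ b) ∧ c ≼ a ∨ (b ∧ c)) where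

    meet-modular : ∀ a b c → a ∧ (b ∨ c) ≼ b ∨ (a ∧ c)
    meet-modular a b c = begin
      a ∧ (b ∨ c)  ≡⟨ ∧-comm a (b ∨ c) ⟩
      (b ∨ c) ∧ a  ≤⟨ modular b c a ⟩
      b ∨ (c ∧ a)  ≡⟨ cong (b ∨_) (∧-comm c a) ⟩
      b ∨ (a ∧ c)  ∎

    absorb-into-join : ∀ a b c → a ∧ (b ∨ c) ≡ a ∧ (b ∨ (a ∧ c))
    absorb-into-join a b c = ≼-antisym
      (∧-greatest (x∧y≤x a (b ∨ c)) (meet-modular a b c))
      (∧-monotonic ≼-refl (∨-monotonic ≼-refl (x∧y≤y a c)))

    meet-distrib-join : ∀ a b c → a ∧ (b ∨ c) ≡ (a ∧ b) ∨ (a ∧ c)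
    meet-distrib-join a b c = ≼-antisym
      (begin
        a ∧ (b ∨ c)          ≡⟨ absorb-into-join a b c ⟩
        a ∧ (b ∨ (a ∧ c))    ≡⟨ cong (a ∧_) (∨-comm b (a ∧ c)) ⟩
        a ∧ ((a ∧ c) ∨ b)    ≤⟨ meet-modular a (a ∧ c) b ⟩
        (a ∧ c) ∨ (a ∧ b)    ≡⟨ ∨-comm (a ∧ c) (a ∧ b) ⟩
        (a ∧ b) ∨ (a ∧ c)    ∎)
      (∨-least (∧-monotonic ≼-refl (x≤x∨y b c)) (∧-monotonic ≼-refl (y≤x∨y b c)))

-- Bounded lattices: the extremal elements 0 and 1 distribute over everything,
-- which is all that is needed to verify the antiortholattice inequalities.
module BoundedLattice (A : BZAlg) (lat : IsLatticeReduct A)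
  (𝟘-least : ∀ a → BZAlg._≤_ A (BZAlg.𝟘 A) a)
  (𝟙-greatest : ∀ a → BZAlg._≤_ A a (BZAlg.𝟙 A)) where
  open BZAlg A
  open LatticeOrder A lat

  Extremal : Carrier → Set
  Extremal d = d ≡ 𝟘 ⊎ d ≡ 𝟙

  ⊥≼ : ∀ a → 𝟘 ≼ a
  ⊥≼ a = ≤⇒≼ (𝟘-least a)

  ≼⊤ : ∀ a → a ≼ 𝟙
  ≼⊤ a = ≤⇒≼ (𝟙-greatest a)

  extremal-split : ∀ {d} → Extremal d → ∀ a b e →
                   (a ∨ b) ∧ (d ∨ e) ≼ (a ∨ (b ∧ d)) ∨ e
  extremal-split (inj₁ refl) a b e = begin
    (a ∨ b) ∧ (𝟘 ∨ e)      ≤⟨ x∧y≤y (a ∨ b) (𝟘 ∨ e) ⟩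
    𝟘 ∨ e                  ≤⟨ ∨-monotonic (⊥≼ _) ≼-refl ⟩
    (a ∨ (b ∧ 𝟘)) ∨ e      ∎
  extremal-split (inj₂ refl) a b e = begin
    (a ∨ b) ∧ (𝟙 ∨ e)      ≤⟨ x∧y≤x (a ∨ b) (𝟙 ∨ e) ⟩
    a ∨ b                  ≤⟨ ∨-monotonic ≼-refl (∧-greatest ≼-refl (≼⊤ b)) ⟩
    a ∨ (b ∧ 𝟙)            ≤⟨ x≤x∨y (a ∨ (b ∧ 𝟙)) e ⟩
    (a ∨ (b ∧ 𝟙)) ∨ e      ∎

  -- For b ≤ d ∈ {0,1}, the element X = (a ∨ b) ∧ c is covered by a ∨ (X ∧ d):
  -- either d = 1, or b = 0 and X ≤ a.
  extremal-cover : ∀ {d} → Extremal d → ∀ a b c → b ≼ d →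
                   (a ∨ b) ∧ c ≼ a ∨ (((a ∨ b) ∧ c) ∧ d)
  extremal-cover (inj₁ refl) a b c b≼𝟘 = begin
    (a ∨ b) ∧ c                  ≤⟨ x∧y≤x (a ∨ b) c ⟩
    a ∨ b                        ≤⟨ ∨-least ≼-refl (≼-trans b≼𝟘 (⊥≼ a)) ⟩
    a                            ≤⟨ x≤x∨y a _ ⟩
    a ∨ (((a ∨ b) ∧ c) ∧ 𝟘)      ∎
  extremal-cover (inj₂ refl) a b c _ = begin
    (a ∨ b) ∧ c                  ≤⟨ ∧-greatest ≼-refl (≼⊤ _) ⟩
    ((a ∨ b) ∧ c) ∧ 𝟙            ≤⟨ y≤x∨y a _ ⟩
    a ∨ (((a ∨ b) ∧ c) ∧ 𝟙)      ∎

  -- For e ≤ X = (a ∨ b) ∧ c with e ∈ {0,1}:  X ∧ (e ∨ b) ≤ a ∨ (b ∧ c).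
  -- If e = 0 the left side is below b ∧ c; if e = 1 then X = 1, so c = 1.
  extremal-bound : ∀ {e} → Extremal e → ∀ a b c → e ≼ (a ∨ b) ∧ c →
                   ((a ∨ b) ∧ c) ∧ (e ∨ b) ≼ a ∨ (b ∧ c)
  extremal-bound (inj₁ refl) a b c _ = begin
    ((a ∨ b) ∧ c) ∧ (𝟘 ∨ b)  ≤⟨ ∧-monotonic (x∧y≤y (a ∨ b) c) (∨-least (⊥≼ b) ≼-refl) ⟩
    c ∧ b                    ≡⟨ ∧-comm c b ⟩
    b ∧ c                    ≤⟨ y≤x∨y a (b ∧ c) ⟩
    a ∨ (b ∧ c)              ∎
  extremal-bound (inj₂ refl) a b c 𝟙≼X = begin
    ((a ∨ b) ∧ c) ∧ (𝟙 ∨ b)  ≤⟨ ≼-trans (x∧y≤x _ _) (x∧y≤x (a ∨ b) c) ⟩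
    a ∨ b                    ≤⟨ ∨-monotonic ≼-refl (∧-greatest ≼-refl b≼c) ⟩
    a ∨ (b ∧ c)              ∎
    where
    b≼c : b ≼ c
    b≼c = ≼-trans (≼⊤ b) (≼-trans 𝟙≼X (x∧y≤y (a ∨ b) c))

module Antiortholattice (A : BZAlg) (aol : IsAOL A) where
  open BZAlg A
  open IsAOL aol

  latticeReduct : IsLatticeReduct A
  latticeReduct = record
    { isEquivalence = isEquivalence
    ; ∨-comm        = ∨-comm
    ; ∨-assoc       = ∨-assoc
    ; ∨-cong        = cong₂ _∨_
    ; ∧-comm        = ∧-comm
    ; ∧-assoc       = ∧-assoc
    ; ∧-cong        = cong₂ _∧_
    ; absorptive    = ∨-absorb , ∧-absorb
    }

  open LatticeOrder A latticeReduct
  open BoundedLattice A latticeReduct 𝟘-least 𝟙-greatest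

  -- x~ is sharp, as x~ ∧ x~′ = x~ ∧ x~~ = 0; so it is 0 or 1.
  ~-extremal : ∀ x → Extremal (x ~)
  ~-extremal x = sharp01 (x ~) (trans (cong (x ~ ∧_) (~′ x)) (~-meet (x ~)))

  -- In any BZ-lattice x~~~ = x~ (from x ≤ x~~ and antitonicity of ~).
  ~-triple : ∀ x → (◇ x) ~ ≡ x ~
  ~-triple x = ≼-antisym (≤⇒≼ (~-antitone x (◇ x) (~-dbl x))) (≤⇒≼ (~-dbl (x ~)))

  -- Hence x~ = (x~~)′ ≤ x′ and so □x = x′~ ≤ x′′ = x; only BZ axioms are used.
  □-below : ∀ x → □ x ≼ x
  □-below x = begin
    (x ′) ~          ≡⟨ sym (~-triple (x ′)) ⟩
    (◇ (x ′)) ~      ≡⟨ sym (~′ ((x ′) ~)) ⟩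
    (◇ (x ′)) ′      ≤⟨ ≤⇒≼ (′-antitone (x ′) (◇ (x ′)) (~-dbl (x ′))) ⟩
    (x ′) ′          ≡⟨ ′-invol x ⟩
    x                ∎

  □-deflationary : ∀ x → □ x ≤ x
  □-deflationary x = ≼⇒≤ (□-below x)

  split-◇□ : ∀ a b → ((a ∨ b) ∧ (◇ a ∨ □ b)) ≤ ((a ∨ (b ∧ ◇ a)) ∨ □ b)
  split-◇□ a b = ≼⇒≤ (extremal-split (~-extremal (a ~)) a b (□ b))

  cover-◇ : ∀ a b c → ((a ∨ b) ∧ c) ≤ (a ∨ (((a ∨ b) ∧ c) ∧ ◇ b))
  cover-◇ a b c = ≼⇒≤ (extremal-cover (~-extremal (b ~)) a b c (≤⇒≼ (~-dbl b)))

  bound-□ : ∀ a b c → (((a ∨ b) ∧ c) ∧ (□ ((a ∨ b) ∧ c) ∨ b)) ≤ (a ∨ (b ∧ c))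
  bound-□ a b c =
    ≼⇒≤ (extremal-bound (~-extremal (((a ∨ b) ∧ c) ′)) a b c (□-below _))

x₀ x₁ x₂ : Term
x₀ = var 0
x₁ = var 1
x₂ = var 2

◇ₜ □ₜ : Term → Term
◇ₜ t = (t ~ₜ) ~ₜ
□ₜ t = (t ′ₜ) ~ₜ

module Transfer (L : BZAlg) (modL : ModEqAOL L) where
  open BZAlg L

  valuation : Carrier → Carrier → Carrier → ℕ → Carrier
  valuation a b c 0 = a
  valuation a b c 1 = b
  valuation a b c _ = c

  holds : ∀ t u → InEqAOL t u → ∀ a b c →
          eval L (valuation a b c) t ≡ eval L (valuation a b c) u
  holds t u valid a b c = modL t u valid (valuation a b c)

  -- An inequality t ≤ u is the identity t ∧ u ≈ t.
  holds≤ : ∀ t u →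
           (∀ A → IsAOL A → ∀ ρ → BZAlg._≤_ A (eval A ρ t) (eval A ρ u)) →
           ∀ a b c → eval L (valuation a b c) t ≤ eval L (valuation a b c) u
  holds≤ t u valid = holds (t ∧ₜ u) t valid

  latticeReduct : IsLatticeReduct L
  latticeReduct = record
    { isEquivalence = isEquivalence
    ; ∨-comm        = λ a b → holds (x₀ ∨ₜ x₁) (x₁ ∨ₜ x₀)
                        (λ _ aol ρ → IsAOL.∨-comm aol (ρ 0) (ρ 1)) a b b
    ; ∨-assoc       = holds ((x₀ ∨ₜ x₁) ∨ₜ x₂) (x₀ ∨ₜ (x₁ ∨ₜ x₂))
                        (λ _ aol ρ → IsAOL.∨-assoc aol (ρ 0) (ρ 1) (ρ 2))
    ; ∨-cong        = cong₂ _∨_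
    ; ∧-comm        = λ a b → holds (x₀ ∧ₜ x₁) (x₁ ∧ₜ x₀)
                        (λ _ aol ρ → IsAOL.∧-comm aol (ρ 0) (ρ 1)) a b b
    ; ∧-assoc       = holds ((x₀ ∧ₜ x₁) ∧ₜ x₂) (x₀ ∧ₜ (x₁ ∧ₜ x₂))
                        (λ _ aol ρ → IsAOL.∧-assoc aol (ρ 0) (ρ 1) (ρ 2))
    ; ∧-cong        = cong₂ _∧_
    ; absorptive    =
        (λ a b → holds (x₀ ∨ₜ (x₀ ∧ₜ x₁)) x₀
                   (λ _ aol ρ → IsAOL.∨-absorb aol (ρ 0) (ρ 1)) a b b) ,
        (λ a b → holds (x₀ ∧ₜ (x₀ ∨ₜ x₁)) x₀
                   (λ _ aol ρ → IsAOL.∧-absorb aol (ρ 0) (ρ 1)) a b b)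
    }

module SKModel (L : BZAlg) (modL : ModEqAOL L) (sk : SK L) where
  open BZAlg L
  open Transfer L modL
  open LatticeOrder L latticeReduct

  ◇-inflationary : ∀ a → a ≼ ◇ a
  ◇-inflationary a = ≤⇒≼ (holds≤ x₀ (◇ₜ x₀)
    (λ _ aol ρ → IsAOL.~-dbl aol (ρ 0)) a a a)

  □-deflationary : ∀ a → □ a ≼ a
  □-deflationary a = ≤⇒≼ (holds≤ (□ₜ x₀) x₀
    (λ A aol ρ → Antiortholattice.□-deflationary A aol (ρ 0)) a a a)

  split-◇□ : ∀ a b → (a ∨ b) ∧ (◇ a ∨ □ b) ≼ (a ∨ (b ∧ ◇ a)) ∨ □ b
  split-◇□ a b = ≤⇒≼ (holds≤
    ((x₀ ∨ₜ x₁) ∧ₜ (◇ₜ x₀ ∨ₜ □ₜ x₁)) ((x₀ ∨ₜ (x₁ ∧ₜ ◇ₜ x₀)) ∨ₜ □ₜ x₁)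
    (λ A aol ρ → Antiortholattice.split-◇□ A aol (ρ 0) (ρ 1)) a b b)

  Xₜ : Term
  Xₜ = (x₀ ∨ₜ x₁) ∧ₜ x₂

  cover-◇ : ∀ a b c → (a ∨ b) ∧ c ≼ a ∨ (((a ∨ b) ∧ c) ∧ ◇ b)
  cover-◇ a b c = ≤⇒≼ (holds≤ Xₜ (x₀ ∨ₜ (Xₜ ∧ₜ ◇ₜ x₁))
    (λ A aol ρ → Antiortholattice.cover-◇ A aol (ρ 0) (ρ 1) (ρ 2)) a b c)

  bound-□ : ∀ a b c → ((a ∨ b) ∧ c) ∧ (□ ((a ∨ b) ∧ c) ∨ b) ≼ a ∨ (b ∧ c)
  bound-□ a b c = ≤⇒≼ (holds≤ (Xₜ ∧ₜ (□ₜ Xₜ ∨ₜ x₁)) (x₀ ∨ₜ (x₁ ∧ₜ x₂))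
    (λ A aol ρ → Antiortholattice.bound-□ A aol (ρ 0) (ρ 1) (ρ 2)) a b c)

  -- (SK) with x = X and y = b, combined with bound-□, removes the defect term.
  defect-bound : ∀ a b c → ((a ∨ b) ∧ c) ∧ ◇ b ≼ a ∨ (b ∧ c)
  defect-bound a b c = begin
    X ∧ ◇ b          ≤⟨ ∧-greatest (x∧y≤x X (◇ b)) (≤⇒≼ (sk X b)) ⟩
    X ∧ (□ X ∨ b)    ≤⟨ bound-□ a b c ⟩
    a ∨ (b ∧ c)      ∎
    where
    X : Carrier
    X = (a ∨ b) ∧ c

  modular : ∀ a b c → (a ∨ b) ∧ c ≼ a ∨ (b ∧ c)
  modular a b c = begin
    (a ∨ b) ∧ c                   ≤⟨ cover-◇ a b c ⟩
    a ∨ (((a ∨ b) ∧ c) ∧ ◇ b)     ≤⟨ ∨-least (x≤x∨y a (b ∧ c)) (defect-bound a b c) ⟩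
    a ∨ (b ∧ c)                   ∎

  open Distributivity modular public

  -- Conclusion (i): the defect term b ∧ ◇a of split-◇□ is absorbed by (SK).
  law-i : ∀ a b → a ∨ □ b ≡ (a ∨ b) ∧ (◇ a ∨ □ b)
  law-i a b = ≼-antisym
    (∨-least
      (∧-greatest (x≤x∨y a b) (≼-trans (◇-inflationary a) (x≤x∨y (◇ a) (□ b))))
      (∧-greatest (≼-trans (□-deflationary b) (y≤x∨y a b)) (y≤x∨y (◇ a) (□ b))))
    (begin
      (a ∨ b) ∧ (◇ a ∨ □ b)     ≤⟨ split-◇□ a b ⟩
      (a ∨ (b ∧ ◇ a)) ∨ □ b     ≤⟨ ∨-least (∨-least (x≤x∨y a (□ b)) sk-instance)
                                             (y≤x∨y a (□ b)) ⟩
      a ∨ □ b                   ∎)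
    where
    sk-instance : b ∧ ◇ a ≼ a ∨ □ b
    sk-instance = ≼-trans (≤⇒≼ (sk b a)) (≼-reflexive (∨-comm (□ b) a))

  law-iii : ∀ a b c → a ∨ (b ∧ c) ≡ a ∨ ((a ∨ b) ∧ c)
  law-iii a b c = ≼-antisym
    (∨-monotonic ≼-refl (∧-monotonic (y≤x∨y a b) ≼-refl))
    (∨-least (x≤x∨y a (b ∧ c)) (modular a b c))

  -- Conclusion (ii): a ∨ ((◇b ∨ □a) ∧ X) lies between a ∨ (X ∧ ◇b) and a ∨ X,
  -- which both equal a ∨ (b ∧ c) by cover-◇ and (iii).
  law-ii : ∀ a b c → a ∨ (b ∧ c) ≡ a ∨ ((◇ b ∨ □ a) ∧ (a ∨ b) ∧ c)
  law-ii a b c = ≼-antisym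
    (begin
      a ∨ (b ∧ c)                   ≡⟨ law-iii a b c ⟩
      a ∨ X                         ≤⟨ ∨-least (x≤x∨y a _) (cover-◇ a b c) ⟩
      a ∨ (X ∧ ◇ b)                 ≤⟨ ∨-monotonic ≼-refl
                                         (∧-greatest
                                           (≼-trans (x∧y≤y X (◇ b)) (x≤x∨y (◇ b) (□ a)))
                                           (x∧y≤x X (◇ b))) ⟩
      a ∨ ((◇ b ∨ □ a) ∧ X)        ∎)
    (begin
      a ∨ ((◇ b ∨ □ a) ∧ X)        ≤⟨ ∨-monotonic ≼-refl (x∧y≤y (◇ b ∨ □ a) X) ⟩
      a ∨ X                         ≡⟨ law-iii a b c ⟨
      a ∨ (b ∧ c)                   ∎)
    where
    X : Carrier
    X = (a ∨ b) ∧ c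

mainTheorem12 : (L : BZAlg) → ModEqAOL L → SK L → SDM L → Conclusion L
mainTheorem12 L modL sk _ a b c =
  law-i a b , law-ii a b c , law-iii a b c ,
  absorb-into-join a b c , meet-distrib-join a b c
  where open SKModel L modL sk
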